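{- Let $\psi=(\psi_n)_{n\ge 0}$ be a sequence of nonzero real numbers and put $n_\psi=\psi_{n-1}/\psi_n$ for $n\ge 1$. For $k\ge 0$ let $\psi_{\underline k}(x)=x(x-1_\psi)(x-2_\psi)\cdots(x-(k-1)_\psi)$ (with $\psi_{\underline 0}(x)=1$), and define $\left\{{n\atop k}\right\}^\sim_\psi$ by $x^n=\sum_{k=0}^{n}\left\{{n\atop k}\right\}^\sim_\psi\,\psi_{\underline k}(x)$ for $n\ge 0$. Define the polynomials $\varphi^\sim_n(\psi,y)=\sum_{k=0}^{n}\left\{{n\atop k}\right\}^\sim_\psi y^k$, and let $\partial_\psi$ be the linear operator on polynomials in $y$ with $\partial_\psi y^m=m_\psi y^{m-1}$ for $m\ge 1$ and $\partial_\psi 1=0$. Then for all $n\ge 1$, $$\varphi^\sim_n(\psi,y)=y\,(1+\partial_\psi)\,\varphi^\sim_{n-1}(\psi,y),$$ and consequently $\varphi^\sim_n(\psi,y)=[y(1+\partial_\psi)]^n\,1$ for all $n\ge 0$.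
   Context: $y(1+\partial_\psi)$ denotes the operator $p\mapsto y\,(p+\partial_\psi p)$, i.e. apply $1+\partial_\psi$ and then multiply by $y$. -}

module Defs where

open import Level using (_⊔_) renaming (suc to lsuc)
open import Data.Nat using (ℕ; zero; suc; _≤_)
open import Relation.Nullary using (¬_)
open import Algebra.Bundles using (CommutativeRing)

-- A field: a commutative ring with 0 ≠ 1 and multiplicative inverses of
-- nonzero elements (the stdlib has no Field bundle).  ℝ is an instance.
record Field (c ℓ : Level.Level) : Set (lsuc (c ⊔ ℓ)) where
  field
    commutativeRing : CommutativeRing c ℓ
  open CommutativeRing commutativeRing public
  field
    _⁻¹      : Carrier → Carrier
    0≉1      : ¬ (0# ≈ 1#)
    ⁻¹-inverseʳ : ∀ x → ¬ (x ≈ 0#) → (x * (x ⁻¹)) ≈ 1#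

module FieldDefs {c ℓ} (F : Field c ℓ) where
  open Field F

  -- Polynomials in one variable, represented by their coefficient sequences
  -- (coefficient of X^m at position m).  Equality is coefficientwise.
  Poly : Set c
  Poly = ℕ → Carrier

  infix 4 _≈ₚ_
  _≈ₚ_ : Poly → Poly → Set ℓ
  p ≈ₚ q = ∀ m → p m ≈ q m

  oneₚ : Poly
  oneₚ zero    = 1#
  oneₚ (suc _) = 0#

  zeroₚ : Poly
  zeroₚ _ = 0#

  _+ₚ_ : Poly → Poly → Poly
  (p +ₚ q) m = p m + q m

  _·ₚ_ : Carrier → Poly → Poly
  (a ·ₚ p) m = a * p m

  Xₚ* : Poly → Poly
  Xₚ* p zero    = 0#
  Xₚ* p (suc m) = p m

  Xpow : ℕ → Poly
  Xpow zero    = oneₚ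
  Xpow (suc n) = Xₚ* (Xpow n)

  sumₚ : ℕ → (ℕ → Poly) → Poly
  sumₚ zero    f = f 0
  sumₚ (suc n) f = sumₚ n f +ₚ f (suc n)

  sumR : ℕ → (ℕ → Carrier) → Carrier
  sumR zero    f = f 0
  sumR (suc n) f = sumR n f + f (suc n)

  module ψ-notions (ψ : ℕ → Carrier) where

    nψ : ℕ → Carrier
    nψ zero    = 0#
    nψ (suc n) = ψ n * (ψ (suc n) ⁻¹)

    -- ψ-falling factorial  ψ_{\underline k}(x) = x (x - 1_ψ) ... (x - (k-1)_ψ)
    -- ψ_{\underline 0} = 1,   ψ_{\underline{k+1}} = (x - k_ψ) ψ_{\underline k}
    -- (the factor for k = 0 is x itself)
    fallingψ : ℕ → Poly
    fallingψ zero    = oneₚ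
    fallingψ (suc zero) = Xₚ* oneₚ
    fallingψ (suc (suc k)) =
      Xₚ* (fallingψ (suc k)) +ₚ ((- (nψ (suc k))) ·ₚ fallingψ (suc k))

    IsStirlingψ : (ℕ → ℕ → Carrier) → Set ℓ
    IsStirlingψ S = ∀ n → Xpow n ≈ₚ sumₚ n (λ k → S n k ·ₚ fallingψ k)

    φ~ : (ℕ → ℕ → Carrier) → ℕ → Poly
    φ~ S n = sumₚ n (λ k → S n k ·ₚ Xpow k)

    -- ∂_ψ y^m = m_ψ y^{m-1} (m ≥ 1), ∂_ψ 1 = 0, extended linearly
    ∂ψ : Poly → Poly
    ∂ψ p m = nψ (suc m) * p (suc m)

    y[1+∂ψ] : Poly → Poly
    y[1+∂ψ] p = Xₚ* (p +ₚ ∂ψ p)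

    iter : ℕ → Poly → Poly
    iter zero    p = p
    iter (suc n) p = y[1+∂ψ] (iter n p)

-- Multiplication by x acts on the ψ-falling factorials by
-- x ψ_k = ψ_{k+1} + k_ψ ψ_k, so on the coordinates of a polynomial in the
-- basis (ψ_k) it acts as y(1 + ∂_ψ) acts on the coefficients of a polynomial
-- in y.  The polynomial φ~_n has the coordinates of x^n as coefficients, and
-- since the ψ_k are monic of degree k these coordinates are unique; hence
-- φ~_{n+1} = y(1 + ∂_ψ) φ~_n, and iterating from φ~_0 = 1 gives the closed form.
module Submission where

open import Defs
open import Data.Nat using (ℕ; zero; suc; _≤_; _<_; z≤n; s≤s; _≤?_)
open import Data.Nat.Properties using (<⇒≤; n<1+n; m<n⇒m<1+n; m≤n⇒m≤1+n; m≤n⇒m<n∨m≡n; ≰⇒>)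
open import Data.Product using (_×_; _,_)
open import Data.Sum using (inj₁; inj₂)
open import Relation.Nullary using (¬_; yes; no)
open import Relation.Binary.Bundles using (Setoid)
open import Relation.Binary.PropositionalEquality using () renaming (refl to ≡-refl)
import Relation.Binary.Reasoning.Setoid as SetoidReasoning
import Algebra.Properties.Group as GroupProperties
import Algebra.Properties.CommutativeSemigroup as CommutativeSemigroupProperties

module Polynomials {c ℓ} (F : Field c ℓ) where
  open Field F hiding (zero)
  open FieldDefs F
  open GroupProperties +-group using () renaming (∙-cancelʳ to +-cancelʳ)
  open CommutativeSemigroupProperties +-commutativeSemigroup using (interchange)

  x≈0∧y≈0⇒x+y≈0 : ∀ {x y} → x ≈ 0# → y ≈ 0# → x + y ≈ 0#
  x≈0∧y≈0⇒x+y≈0 x≈0 y≈0 = trans (+-cong x≈0 y≈0) (+-identityʳ 0#)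

  y≈0⇒x*y≈0 : ∀ x {y} → y ≈ 0# → x * y ≈ 0#
  y≈0⇒x*y≈0 x y≈0 = trans (*-congˡ y≈0) (zeroʳ x)

  ≈ₚ-setoid : Setoid c ℓ
  ≈ₚ-setoid = record
    { Carrier       = Poly
    ; _≈_           = _≈ₚ_
    ; isEquivalence = record
      { refl  = λ _ → refl
      ; sym   = λ p≈q m → sym (p≈q m)
      ; trans = λ p≈q q≈r m → trans (p≈q m) (q≈r m)
      }
    }

  module ≈ₚ = Setoid ≈ₚ-setoid

  +ₚ-cong : ∀ {p p′ q q′} → p ≈ₚ p′ → q ≈ₚ q′ → p +ₚ q ≈ₚ p′ +ₚ q′
  +ₚ-cong p≈p′ q≈q′ m = +-cong (p≈p′ m) (q≈q′ m)

  +ₚ-identityˡ : ∀ p → zeroₚ +ₚ p ≈ₚ p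
  +ₚ-identityˡ p m = +-identityˡ (p m)

  +ₚ-identityʳ : ∀ p → p +ₚ zeroₚ ≈ₚ p
  +ₚ-identityʳ p m = +-identityʳ (p m)

  ·ₚ-congʳ : ∀ {a b} p → a ≈ b → a ·ₚ p ≈ₚ b ·ₚ p
  ·ₚ-congʳ p a≈b m = *-congʳ a≈b

  a≈0⇒a·ₚp≈0 : ∀ {a} p → a ≈ 0# → a ·ₚ p ≈ₚ zeroₚ
  a≈0⇒a·ₚp≈0 p a≈0 m = trans (*-congʳ a≈0) (zeroˡ (p m))

  ·ₚ-distribʳ : ∀ p a b → (a + b) ·ₚ p ≈ₚ (a ·ₚ p) +ₚ (b ·ₚ p)
  ·ₚ-distribʳ p a b m = distribʳ (p m) a b

  ·ₚ-distribˡ : ∀ a p q → a ·ₚ (p +ₚ q) ≈ₚ (a ·ₚ p) +ₚ (a ·ₚ q)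
  ·ₚ-distribˡ a p q m = distribˡ a (p m) (q m)

  ·ₚ-assoc : ∀ a b p → (a * b) ·ₚ p ≈ₚ a ·ₚ (b ·ₚ p)
  ·ₚ-assoc a b p m = *-assoc a b (p m)

  Xₚ*-cong : ∀ {p q} → p ≈ₚ q → Xₚ* p ≈ₚ Xₚ* q
  Xₚ*-cong p≈q zero    = refl
  Xₚ*-cong p≈q (suc m) = p≈q m

  Xₚ*-·ₚ : ∀ a p → Xₚ* (a ·ₚ p) ≈ₚ a ·ₚ Xₚ* p
  Xₚ*-·ₚ a p zero    = sym (zeroʳ a)
  Xₚ*-·ₚ a p (suc m) = refl

  sumₚ-cong : ∀ n {f g : ℕ → Poly} → (∀ k → k ≤ n → f k ≈ₚ g k) → sumₚ n f ≈ₚ sumₚ n g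
  sumₚ-cong zero    f≈g = f≈g 0 z≤n
  sumₚ-cong (suc n) f≈g =
    +ₚ-cong (sumₚ-cong n (λ k k≤n → f≈g k (m≤n⇒m≤1+n k≤n))) (f≈g (suc n) (n<1+n n))

  sumₚ-+ₚ : ∀ n (f g : ℕ → Poly) → sumₚ n (λ k → f k +ₚ g k) ≈ₚ sumₚ n f +ₚ sumₚ n g
  sumₚ-+ₚ zero    f g m = refl
  sumₚ-+ₚ (suc n) f g m = trans (+-congʳ (sumₚ-+ₚ n f g m)) (interchange _ _ _ _)

  Xₚ*-sumₚ : ∀ n (f : ℕ → Poly) → Xₚ* (sumₚ n f) ≈ₚ sumₚ n (λ k → Xₚ* (f k))
  Xₚ*-sumₚ zero    f m       = refl
  Xₚ*-sumₚ (suc n) f zero    = sym (x≈0∧y≈0⇒x+y≈0 (sym (Xₚ*-sumₚ n f zero)) refl)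
  Xₚ*-sumₚ (suc n) f (suc m) = +-congʳ (Xₚ*-sumₚ n f (suc m))

  sumₚ-head : ∀ n (f : ℕ → Poly) → sumₚ (suc n) f ≈ₚ f 0 +ₚ sumₚ n (λ k → f (suc k))
  sumₚ-head zero    f m = refl
  sumₚ-head (suc n) f m = trans (+-congʳ (sumₚ-head n f m)) (+-assoc _ _ _)

  combination : ℕ → (ℕ → Carrier) → (ℕ → Poly) → Poly
  combination n a g = sumₚ n (λ k → a k ·ₚ g k)

  combination-cong : ∀ n {a b} g → (∀ k → k ≤ n → a k ≈ b k) →
                     combination n a g ≈ₚ combination n b g
  combination-cong n g a≈b = sumₚ-cong n (λ k k≤n → ·ₚ-congʳ (g k) (a≈b k k≤n))

  Deg≤ : ℕ → Poly → Set ℓ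
  Deg≤ d p = ∀ m → d < m → p m ≈ 0#

  Deg≤-suc : ∀ {d p} → Deg≤ d p → Deg≤ (suc d) p
  Deg≤-suc p-deg m d+1<m = p-deg m (<⇒≤ d+1<m)

  Deg≤-ext : ∀ d {p q} → Deg≤ d p → Deg≤ d q → (∀ m → m ≤ d → p m ≈ q m) → p ≈ₚ q
  Deg≤-ext d p-deg q-deg p≈q m with m ≤? d
  ... | yes m≤d = p≈q m m≤d
  ... | no  m≰d = trans (p-deg m (≰⇒> m≰d)) (sym (q-deg m (≰⇒> m≰d)))

  oneₚ-deg≤ : Deg≤ 0 oneₚ
  oneₚ-deg≤ (suc m) _ = refl

  +ₚ-deg≤ : ∀ {d p q} → Deg≤ d p → Deg≤ d q → Deg≤ d (p +ₚ q)
  +ₚ-deg≤ p-deg q-deg m d<m = x≈0∧y≈0⇒x+y≈0 (p-deg m d<m) (q-deg m d<m)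

  ·ₚ-deg≤ : ∀ {d p} a → Deg≤ d p → Deg≤ d (a ·ₚ p)
  ·ₚ-deg≤ a p-deg m d<m = y≈0⇒x*y≈0 a (p-deg m d<m)

  Xₚ*-deg≤ : ∀ {d p} → Deg≤ d p → Deg≤ (suc d) (Xₚ* p)
  Xₚ*-deg≤ p-deg (suc m) (s≤s d<m) = p-deg m d<m

  Xpow-deg≤ : ∀ k → Deg≤ k (Xpow k)
  Xpow-deg≤ zero    = oneₚ-deg≤
  Xpow-deg≤ (suc k) = Xₚ*-deg≤ (Xpow-deg≤ k)

  Xpow-monic : ∀ k → Xpow k k ≈ 1#
  Xpow-monic zero    = refl
  Xpow-monic (suc k) = Xpow-monic k

  Xpow-vanishes-below : ∀ {k m} → m < k → Xpow k m ≈ 0#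
  Xpow-vanishes-below {suc k} {zero}  _         = refl
  Xpow-vanishes-below {suc k} {suc m} (s≤s m<k) = Xpow-vanishes-below m<k

  module MonicFamily (g : ℕ → Poly) (g-deg≤ : ∀ k → Deg≤ k (g k)) (g-monic : ∀ k → g k k ≈ 1#) where

    combination-deg≤ : ∀ n a → Deg≤ n (combination n a g)
    combination-deg≤ zero    a = ·ₚ-deg≤ (a 0) (g-deg≤ 0)
    combination-deg≤ (suc n) a =
      +ₚ-deg≤ (Deg≤-suc (combination-deg≤ n a)) (·ₚ-deg≤ (a (suc n)) (g-deg≤ (suc n)))

    combination-top : ∀ n a → combination n a g n ≈ a n
    combination-top zero    a = trans (*-congˡ (g-monic 0)) (*-identityʳ (a 0))
    combination-top (suc n) a = begin
      combination n a g (suc n) + a (suc n) * g (suc n) (suc n)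
        ≈⟨ +-cong (combination-deg≤ n a (suc n) (n<1+n n)) (*-congˡ (g-monic (suc n))) ⟩
      0# + a (suc n) * 1#
        ≈⟨ trans (+-identityˡ _) (*-identityʳ _) ⟩
      a (suc n) ∎
      where open SetoidReasoning setoid

    combination-top-injective : ∀ n a b → combination n a g ≈ₚ combination n b g → a n ≈ b n
    combination-top-injective n a b a≈b =
      trans (sym (combination-top n a)) (trans (a≈b n) (combination-top n b))

    combination-injective : ∀ n a b → combination n a g ≈ₚ combination n b g →
                            ∀ k → k ≤ n → a k ≈ b k
    combination-injective n a b a≈b k k≤n with m≤n⇒m<n∨m≡n k≤n
    ... | inj₂ ≡-refl = combination-top-injective n a b a≈b
    combination-injective (suc n) a b a≈b k _ | inj₁ (s≤s k≤n) =
      combination-injective n a b lower≈ k k≤n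
      where
      lower≈ : combination n a g ≈ₚ combination n b g
      lower≈ m = +-cancelʳ _ _ _ (trans (a≈b m)
        (+-congˡ (*-congʳ (sym (combination-top-injective (suc n) a b a≈b)))))

  module Monomials = MonicFamily Xpow Xpow-deg≤ Xpow-monic

  combination-Xpow-coeff : ∀ n b m → m ≤ n → combination n b Xpow m ≈ b m
  combination-Xpow-coeff n b m m≤n with m≤n⇒m<n∨m≡n m≤n
  ... | inj₂ ≡-refl = Monomials.combination-top n b
  combination-Xpow-coeff (suc n) b m _ | inj₁ (s≤s m≤n) =
    trans (+-cong (combination-Xpow-coeff n b m m≤n)
                  (y≈0⇒x*y≈0 (b (suc n)) (Xpow-vanishes-below (s≤s m≤n))))
          (+-identityʳ (b m))

module ψ-Calculus {c ℓ} (F : Field c ℓ) (ψ : ℕ → Field.Carrier F) where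
  open Field F hiding (zero)
  open FieldDefs F
  open Polynomials F
  open ψ-notions ψ

  fallingψ-deg≤ : ∀ k → Deg≤ k (fallingψ k)
  fallingψ-deg≤ zero          = oneₚ-deg≤
  fallingψ-deg≤ (suc zero)    = Xₚ*-deg≤ oneₚ-deg≤
  fallingψ-deg≤ (suc (suc k)) =
    +ₚ-deg≤ (Xₚ*-deg≤ (fallingψ-deg≤ (suc k))) (·ₚ-deg≤ _ (Deg≤-suc (fallingψ-deg≤ (suc k))))

  fallingψ-monic : ∀ k → fallingψ k k ≈ 1#
  fallingψ-monic zero          = refl
  fallingψ-monic (suc zero)    = refl
  fallingψ-monic (suc (suc k)) =
    trans (+-cong (fallingψ-monic (suc k))
                  (y≈0⇒x*y≈0 _ (fallingψ-deg≤ (suc k) (suc (suc k)) (n<1+n (suc k)))))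
          (+-identityʳ 1#)

  module FallingBasis = MonicFamily fallingψ fallingψ-deg≤ fallingψ-monic

  -- For k = 0 this is x ψ_0 = ψ_1, thanks to the junk value nψ 0 = 0.
  Xₚ*-fallingψ : ∀ k → Xₚ* (fallingψ k) ≈ₚ fallingψ (suc k) +ₚ (nψ k ·ₚ fallingψ k)
  Xₚ*-fallingψ zero          = ≈ₚ.sym (≈ₚ.trans (+ₚ-cong ≈ₚ.refl (a≈0⇒a·ₚp≈0 oneₚ refl))
                                                (+ₚ-identityʳ (fallingψ 1)))
  Xₚ*-fallingψ (suc k) m = sym (begin
    (Xₚ* p m + (- κ) * p m) + κ * p m  ≈⟨ +-assoc _ _ _ ⟩
    Xₚ* p m + ((- κ) * p m + κ * p m)  ≈⟨ +-congˡ (sym (distribʳ (p m) (- κ) κ)) ⟩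
    Xₚ* p m + (- κ + κ) * p m          ≈⟨ +-congˡ (trans (*-congʳ (-‿inverseˡ κ)) (zeroˡ (p m))) ⟩
    Xₚ* p m + 0#                       ≈⟨ +-identityʳ _ ⟩
    Xₚ* p m                            ∎)
    where
    open SetoidReasoning setoid
    p : Poly
    p = fallingψ (suc k)
    κ : Carrier
    κ = nψ (suc k)

  y[1+∂ψ]-coeff : ∀ a k → y[1+∂ψ] a k ≈ Xₚ* a k + nψ k * a k
  y[1+∂ψ]-coeff a zero    = sym (x≈0∧y≈0⇒x+y≈0 refl (zeroˡ (a 0)))
  y[1+∂ψ]-coeff a (suc k) = refl

  y[1+∂ψ]-cong : ∀ {p q} → p ≈ₚ q → y[1+∂ψ] p ≈ₚ y[1+∂ψ] q
  y[1+∂ψ]-cong p≈q = Xₚ*-cong (+ₚ-cong p≈q (λ m → *-congˡ (p≈q (suc m))))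

  ∂ψ-deg≤ : ∀ {d p} → Deg≤ d p → Deg≤ d (∂ψ p)
  ∂ψ-deg≤ p-deg m d<m = y≈0⇒x*y≈0 _ (p-deg (suc m) (m<n⇒m<1+n d<m))

  y[1+∂ψ]-deg≤ : ∀ {d p} → Deg≤ d p → Deg≤ (suc d) (y[1+∂ψ] p)
  y[1+∂ψ]-deg≤ p-deg = Xₚ*-deg≤ (+ₚ-deg≤ p-deg (∂ψ-deg≤ p-deg))

  Xₚ*-combination-fallingψ : ∀ n a → a (suc n) ≈ 0# →
    Xₚ* (combination n a fallingψ) ≈ₚ combination (suc n) (y[1+∂ψ] a) fallingψ
  Xₚ*-combination-fallingψ n a a[1+n]≈0 = begin
    Xₚ* (combination n a fallingψ)
      ≈⟨ Xₚ*-sumₚ n _ ⟩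
    sumₚ n (λ k → Xₚ* (a k ·ₚ fallingψ k))
      ≈⟨ sumₚ-cong n (λ k _ → Xₚ*-term k) ⟩
    sumₚ n (λ k → (a k ·ₚ fallingψ (suc k)) +ₚ ((nψ k * a k) ·ₚ fallingψ k))
      ≈⟨ sumₚ-+ₚ n _ _ ⟩
    sumₚ n (λ k → a k ·ₚ fallingψ (suc k)) +ₚ combination n b fallingψ
      ≈⟨ +ₚ-cong shifted drop-top ⟩
    combination (suc n) (Xₚ* a) fallingψ +ₚ combination (suc n) b fallingψ
      ≈⟨ ≈ₚ.sym (sumₚ-+ₚ (suc n) _ _) ⟩
    sumₚ (suc n) (λ k → (Xₚ* a k ·ₚ fallingψ k) +ₚ (b k ·ₚ fallingψ k))
      ≈⟨ sumₚ-cong (suc n) (λ k _ → ≈ₚ.sym (·ₚ-distribʳ (fallingψ k) (Xₚ* a k) (b k))) ⟩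
    combination (suc n) (λ k → Xₚ* a k + b k) fallingψ
      ≈⟨ combination-cong (suc n) fallingψ (λ k _ → sym (y[1+∂ψ]-coeff a k)) ⟩
    combination (suc n) (y[1+∂ψ] a) fallingψ ∎
    where
    open SetoidReasoning ≈ₚ-setoid
    b : ℕ → Carrier
    b k = nψ k * a k

    Xₚ*-term : ∀ k → Xₚ* (a k ·ₚ fallingψ k) ≈ₚ (a k ·ₚ fallingψ (suc k)) +ₚ (b k ·ₚ fallingψ k)
    Xₚ*-term k = begin
      Xₚ* (a k ·ₚ fallingψ k)
        ≈⟨ Xₚ*-·ₚ (a k) (fallingψ k) ⟩
      a k ·ₚ Xₚ* (fallingψ k)
        ≈⟨ (λ m → *-congˡ (Xₚ*-fallingψ k m)) ⟩
      a k ·ₚ (fallingψ (suc k) +ₚ (nψ k ·ₚ fallingψ k))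
        ≈⟨ ·ₚ-distribˡ (a k) _ _ ⟩
      (a k ·ₚ fallingψ (suc k)) +ₚ (a k ·ₚ (nψ k ·ₚ fallingψ k))
        ≈⟨ +ₚ-cong ≈ₚ.refl (≈ₚ.trans (≈ₚ.sym (·ₚ-assoc (a k) (nψ k) (fallingψ k)))
                                     (·ₚ-congʳ (fallingψ k) (*-comm (a k) (nψ k)))) ⟩
      (a k ·ₚ fallingψ (suc k)) +ₚ (b k ·ₚ fallingψ k) ∎

    shifted : sumₚ n (λ k → a k ·ₚ fallingψ (suc k)) ≈ₚ combination (suc n) (Xₚ* a) fallingψ
    shifted = ≈ₚ.sym (≈ₚ.trans (sumₚ-head n _)
      (≈ₚ.trans (+ₚ-cong (a≈0⇒a·ₚp≈0 oneₚ refl) ≈ₚ.refl) (+ₚ-identityˡ _)))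

    drop-top : combination n b fallingψ ≈ₚ combination (suc n) b fallingψ
    drop-top = ≈ₚ.sym (≈ₚ.trans
      (+ₚ-cong ≈ₚ.refl (a≈0⇒a·ₚp≈0 (fallingψ (suc n)) (y≈0⇒x*y≈0 _ a[1+n]≈0)))
      (+ₚ-identityʳ _))

  module _ (S : ℕ → ℕ → Carrier) (S-expands : IsStirlingψ S) where

    φ~-deg≤ : ∀ n → Deg≤ n (φ~ S n)
    φ~-deg≤ n = Monomials.combination-deg≤ n (S n)

    Xpow-in-fallingψ-basis : ∀ n → Xpow n ≈ₚ combination n (φ~ S n) fallingψ
    Xpow-in-fallingψ-basis n = ≈ₚ.trans (S-expands n)
      (combination-cong n fallingψ (λ k k≤n → sym (combination-Xpow-coeff n (S n) k k≤n)))

    Stirlingψ-recurrence : ∀ n k → k ≤ suc n → S (suc n) k ≈ y[1+∂ψ] (φ~ S n) k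
    Stirlingψ-recurrence n =
      FallingBasis.combination-injective (suc n) (S (suc n)) (y[1+∂ψ] (φ~ S n)) (begin
        combination (suc n) (S (suc n)) fallingψ
          ≈⟨ ≈ₚ.sym (S-expands (suc n)) ⟩
        Xₚ* (Xpow n)
          ≈⟨ Xₚ*-cong (Xpow-in-fallingψ-basis n) ⟩
        Xₚ* (combination n (φ~ S n) fallingψ)
          ≈⟨ Xₚ*-combination-fallingψ n (φ~ S n) (φ~-deg≤ n (suc n) (n<1+n n)) ⟩
        combination (suc n) (y[1+∂ψ] (φ~ S n)) fallingψ ∎)
      where open SetoidReasoning ≈ₚ-setoid

    φ~-suc : ∀ n → φ~ S (suc n) ≈ₚ y[1+∂ψ] (φ~ S n)
    φ~-suc n = Deg≤-ext (suc n) (φ~-deg≤ (suc n)) (y[1+∂ψ]-deg≤ (φ~-deg≤ n))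
      (λ m m≤1+n → trans (combination-Xpow-coeff (suc n) (S (suc n)) m m≤1+n)
                         (Stirlingψ-recurrence n m m≤1+n))

    φ~-iter : ∀ n → φ~ S n ≈ₚ iter n oneₚ
    φ~-iter zero    = ≈ₚ.sym (S-expands 0)
    φ~-iter (suc n) = ≈ₚ.trans (φ~-suc n) (y[1+∂ψ]-cong (φ~-iter n))

mainTheorem4 : ∀ {c ℓ} (F : Field c ℓ) → let open Field F in let open FieldDefs F in
    (ψ : ℕ → Carrier) → (∀ n → ¬ (ψ n ≈ 0#)) →
    let open ψ-notions ψ in
    (S : ℕ → ℕ → Carrier) → IsStirlingψ S →
    (∀ n → φ~ S (suc n) ≈ₚ y[1+∂ψ] (φ~ S n))
    × (∀ n → φ~ S n ≈ₚ iter n oneₚ)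
mainTheorem4 F ψ _ S S-expands = φ~-suc S S-expands , φ~-iter S S-expands
  where open ψ-Calculus F ψ
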